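{- Let $\pi$ be a permutation of $V(T[h,k])$ and let $h_0,h_1$ be integers with $h_0+\log_3 k+1<h_1\le h$. Suppose $\pi$ is not $(h_0,h_1)$-TD. Then $\pi$ is $(h_0,h_2)$-BU, where $h_2=h_1-\lceil\log_3 k\rceil$.
   Context: $T[h]$ is the complete rooted ternary tree of height $h$; $T[h,k]=T[h]\square P_k$ (Cartesian product with the path on $[k]$); $V(h,k)=V(T[h,k])$. Prefixes of permutations are identified with their sets. Height of a node of $T[h]$ = distance to a leaf; $V_a(h)$ = nodes of height $a$; for $t\in V(T[h])$, $V(h,t)$ = descendants of $t$ including $t$, $V_a(h,t)=V(h,t)\cap V_a(h)$, $V(h,k,t)=V(h,t)\times[k]$, $V_{>a}(h,k,t)=\{(s,i)\in V(h,k,t):height(s)>a\}$, $\mathbf S_a(h,k,t)=\{V(h,t')\times[k]:t'\in V_a(h,t)\}$. For $h_0<h_1\le h$: $\pi$ is $(h_0,h_1)$-TD if for every $t\in V_{h_1}(h)$, letting $\pi_0$ be the shortest prefix of $\pi$ with $|\pi_0\cap V_{>h_0}(h,k,t)|\ge k$, some $U\in\mathbf S_{h_0}(h,k,t)$ has $\pi_0\cap U=\emptyset$. $\pi$ is $(h_0,h_1)$-BU if there are $t\in V_{h_1}(h)$ and a prefix $\pi_0$ of $\pi$ such that $\pi_0\cap U\ne\emptyset$ for every $U\in\mathbf S_{h_0}(h,k,t)$ and $\pi_0\cap V_{>h_0}(h,k,t)=\emptyset$. -}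

module Defs where

open import Data.Nat using (ℕ; _∸_; _≤_; _<_; _<?_)
open import Data.Fin using (Fin)
open import Data.Fin.Properties using (_≟_)
open import Data.List using (List; length; take; filter)
open import Data.Product using (Σ; _×_; _,_; proj₁; ∃)
open import Data.Product.Properties using ()
open import Relation.Nullary using (¬_; Dec)
open import Relation.Nullary.Decidable using (_×-dec_)
open import Relation.Binary.PropositionalEquality using (_≡_)
open import Data.List.Membership.Propositional using (_∈_)
open import Data.List.Relation.Unary.Unique.Propositional using (Unique)
open import Data.List.Relation.Binary.Prefix.Heterogeneous using (Prefix)
open import Data.List.Relation.Binary.Prefix.Heterogeneous.Properties using (prefix?)

-- Nodes of the complete rooted ternary tree T[h]: the root is [], the
-- children of a node s are s ++ [c] for c : Fin 3.  Depth = length.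
Node : ℕ → Set
Node h = Σ (List (Fin 3)) (λ s → length s ≤ h)

height : {h : ℕ} → Node h → ℕ
height {h} (s , _) = h ∸ length s

-- t ⊑ s : s is a descendant of t (including t itself)
_⊑_ : {h : ℕ} → Node h → Node h → Set
(t , _) ⊑ (s , _) = Prefix _≡_ t s

_⊑?_ : {h : ℕ} → (t s : Node h) → Dec (t ⊑ s)
(t , _) ⊑? (s , _) = prefix? _≟_ t s

-- vertices of T[h,k] = T[h] □ P_k, path on [k] represented by Fin k
Vtx : ℕ → ℕ → Set
Vtx h k = Node h × Fin k

IsPerm : {h k : ℕ} → List (Vtx h k) → Set
IsPerm {h} {k} π = Unique π × (∀ (v : Vtx h k) → v ∈ π)

InVgt : {h k : ℕ} → ℕ → Node h → Vtx h k → Set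
InVgt a t (s , _) = t ⊑ s × a < height s

InVgt? : {h k : ℕ} → (a : ℕ) → (t : Node h) → (v : Vtx h k) → Dec (InVgt a t v)
InVgt? a t (s , _) = (t ⊑? s) ×-dec (a <? height s)

countVgt : {h k : ℕ} → ℕ → Node h → List (Vtx h k) → ℕ
countVgt a t π₀ = length (filter (InVgt? a t) π₀)

Disjoint : {h k : ℕ} → List (Vtx h k) → Node h → Set
Disjoint π₀ t' = ∀ {v} → v ∈ π₀ → ¬ (t' ⊑ proj₁ v)

TD : {h k : ℕ} → List (Vtx h k) → ℕ → ℕ → Set
TD {h} {k} π h0 h1 =
  ∀ (t : Node h) → height t ≡ h1 →
  ∀ (j : ℕ) →
    k ≤ countVgt h0 t (take j π) →
    (∀ j' → j' < j → countVgt h0 t (take j' π) < k) →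
    ∃ λ (t' : Node h) → t ⊑ t' × height t' ≡ h0 × Disjoint (take j π) t'

BU : {h k : ℕ} → List (Vtx h k) → ℕ → ℕ → Set
BU {h} {k} π h0 h1 =
  ∃ λ (t : Node h) → height t ≡ h1 × ∃ λ (j : ℕ) →
    (∀ (t' : Node h) → t ⊑ t' → height t' ≡ h0 →
       ∃ λ (v : Vtx h k) → v ∈ take j π × t' ⊑ proj₁ v) ×
    (∀ {v} → v ∈ take j π → ¬ InVgt h0 t v)

-- If π is not (h0,h1)-TD, some t of height h1 has a prefix take (n+1) π which is the first to
-- contain k vertices of V_{>h0}(t) and which still meets every height-h0 descendant of t.
-- The prefix take n π has fewer than k ≤ 3^c vertices in V_{>h0}(t), so by pigeonhole some
-- descendant t* of t, c levels down, lies above none of them.  The vertex added last lies in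
-- V_{>h0}(t), hence below no height-h0 node; so take n π already meets every height-h0
-- descendant of t* while avoiding V_{>h0}(t*), and π is (h0, h1 - c)-BU.  Everything ranges
-- over finite sets, so ¬TD yields such a t and n by decidability.
module Submission where

open import Defs
open import Data.Nat using (ℕ; zero; suc; _+_; _∸_; _^_; _≤_; _<_; _≤?_; _<?_; s≤s)
open import Data.Nat.Properties
  using (module ≤-Reasoning; ≤-refl; <⇒≤; <⇒≱; ≮⇒≥; ≰⇒>; <-≤-trans; ≤-pred; ≤-irrelevant;
         m≤n⇒m≤1+n; +-suc; +-assoc; +-identityʳ; +-mono-≤; +-monoʳ-≤; m∸n≤m; ∸-monoʳ-≤;
         ∸-+-assoc; m∸[m∸n]≡n; m+[n∸m]≡n; ^-monoʳ-≤; anyUpTo?; suc-injective)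
open import Data.Fin using (Fin) renaming (zero to f0; suc to fs)
open import Data.Fin.Properties using (_≟_; any?)
open import Data.List using (List; []; _∷_; _++_; [_]; length; take; filter; map)
open import Data.List.Properties using (take-all; length-filter; ++-assoc; length-++; length-map)
open import Data.List.Membership.Propositional using (_∈_; lose; find)
open import Data.List.Membership.Propositional.Properties using (∈-map⁺; ∈-filter⁺)
open import Data.List.Relation.Unary.Any using (Any; here; there)
import Data.List.Relation.Unary.Any as Any
open import Data.List.Relation.Binary.Prefix.Heterogeneous using (Prefix; []; _∷_)
open import Data.List.Relation.Binary.Prefix.Heterogeneous.Properties
  using (prefix?; length-mono) renaming (trans to prefix-trans)
open import Data.Product using (Σ; _×_; _,_; proj₁; ∃)
open import Data.Sum using (_⊎_; inj₁; inj₂)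
import Data.Sum as Sum
open import Data.Empty using (⊥-elim)
open import Function using (_∘_)
open import Relation.Nullary using (¬_; Dec; yes; no; ¬?)
open import Relation.Nullary.Decidable using (map′; _×-dec_)
open import Relation.Unary using (Decidable)
open import Relation.Unary.Properties using (_∪?_)
open import Relation.Binary.PropositionalEquality using (_≡_; refl; sym; trans; cong; subst)

module _ {A : Set} where

  prefix-++ : (t w : List A) → Prefix _≡_ t (t ++ w)
  prefix-++ []      w = []
  prefix-++ (x ∷ t) w = refl ∷ prefix-++ t w

  prefix-++⁻ˡ : (t w : List A) {s : List A} → Prefix _≡_ (t ++ w) s → Prefix _≡_ t s
  prefix-++⁻ˡ t w = prefix-trans trans (prefix-++ t w)

  prefix-∷ʳ-unique : (t : List A) {a b : A} {s : List A} →
                     Prefix _≡_ (t ++ [ a ]) s → Prefix _≡_ (t ++ [ b ]) s → a ≡ b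
  prefix-∷ʳ-unique []      (a≡x ∷ _) (b≡x ∷ _) = trans a≡x (sym b≡x)
  prefix-∷ʳ-unique (_ ∷ t) (_ ∷ p)   (_ ∷ q)   = prefix-∷ʳ-unique t p q

  length-filter-∪ : {P Q : A → Set} (P? : Decidable P) (Q? : Decidable Q) →
                    (∀ {x} → P x → ¬ Q x) → (xs : List A) →
                    length (filter P? xs) + length (filter Q? xs) ≡ length (filter (P? ∪? Q?) xs)
  length-filter-∪ P? Q? disjoint []       = refl
  length-filter-∪ P? Q? disjoint (x ∷ xs) with P? x | Q? x
  ... | yes px | yes qx = ⊥-elim (disjoint px qx)
  ... | yes _  | no _   = cong suc (length-filter-∪ P? Q? disjoint xs)
  ... | no _   | yes _  = trans (+-suc _ _) (cong suc (length-filter-∪ P? Q? disjoint xs))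
  ... | no _   | no _   = length-filter-∪ P? Q? disjoint xs

  ∈-take-suc⁻ : {P : A → Set} (P? : Decidable P) (n : ℕ) (xs : List A) →
                length (filter P? (take n xs)) < length (filter P? (take (suc n) xs)) →
                ∀ {v} → v ∈ take (suc n) xs → v ∈ take n xs ⊎ P v
  ∈-take-suc⁻ P? zero    (x ∷ xs) grows (here refl) with P? x
  ... | yes px = inj₂ px
  ... | no _   = ⊥-elim (<⇒≱ grows ≤-refl)
  ∈-take-suc⁻ P? (suc n) (x ∷ xs) grows (here refl) = inj₁ (here refl)
  ∈-take-suc⁻ P? (suc n) (x ∷ xs) grows (there v∈) with P? x
  ... | yes _ = Sum.map₁ there (∈-take-suc⁻ P? n xs (≤-pred grows) v∈)
  ... | no _  = Sum.map₁ there (∈-take-suc⁻ P? n xs grows v∈)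

any-word? : ∀ {n} {P : List (Fin n) → Set} (m : ℕ) → Decidable P →
            Dec (∃ λ w → length w ≡ m × P w)
any-word? zero    P? = map′ (λ p → [] , refl , p) (λ { ([] , refl , p) → p }) (P? [])
any-word? (suc m) P? =
  map′ (λ (c , w , e , p) → c ∷ w , cong suc e , p)
       (λ { (c ∷ w , e , p) → c , w , suc-injective e , p })
       (any? (λ c → any-word? m (P? ∘ (c ∷_))))

Word : Set
Word = List (Fin 3)

extensions : Word → List Word → List Word
extensions u = filter (prefix? _≟_ u)

children-extensions-≤ : (t : Word) (L : List Word) →
  length (extensions (t ++ [ f0 ]) L) + length (extensions (t ++ [ fs f0 ]) L)
    + length (extensions (t ++ [ fs (fs f0) ]) L) ≤ length L
children-extensions-≤ t L = begin
  length (extensions (t ++ [ f0 ]) L) + length (extensions (t ++ [ fs f0 ]) L)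
    + length (extensions (t ++ [ fs (fs f0) ]) L)
    ≡⟨ cong (_+ length (extensions (t ++ [ fs (fs f0) ]) L)) (length-filter-∪ ext₀ ext₁ 0≢1 L) ⟩
  length (filter (ext₀ ∪? ext₁) L) + length (extensions (t ++ [ fs (fs f0) ]) L)
    ≡⟨ length-filter-∪ (ext₀ ∪? ext₁) ext₂ 01≢2 L ⟩
  length (filter ((ext₀ ∪? ext₁) ∪? ext₂) L)
    ≤⟨ length-filter ((ext₀ ∪? ext₁) ∪? ext₂) L ⟩
  length L ∎
  where
  open ≤-Reasoning
  ext₀ = prefix? _≟_ (t ++ [ f0 ])
  ext₁ = prefix? _≟_ (t ++ [ fs f0 ])
  ext₂ = prefix? _≟_ (t ++ [ fs (fs f0) ])
  0≢1 : ∀ {s} → Prefix _≡_ (t ++ [ f0 ]) s → ¬ Prefix _≡_ (t ++ [ fs f0 ]) s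
  0≢1 p q with () ← prefix-∷ʳ-unique t p q
  01≢2 : ∀ {s} → Prefix _≡_ (t ++ [ f0 ]) s ⊎ Prefix _≡_ (t ++ [ fs f0 ]) s →
         ¬ Prefix _≡_ (t ++ [ fs (fs f0) ]) s
  01≢2 (inj₁ p) q with () ← prefix-∷ʳ-unique t p q
  01≢2 (inj₂ p) q with () ← prefix-∷ʳ-unique t p q

sparse-child : (m : ℕ) (t : Word) (L : List Word) → length L < 3 ^ suc m →
               ∃ λ c → length (extensions (t ++ [ c ]) L) < 3 ^ m
sparse-child m t L L< with any? (λ c → length (extensions (t ++ [ c ]) L) <? 3 ^ m)
... | yes sparse = sparse
... | no  none   = ⊥-elim (<⇒≱ L< (begin
  3 ^ suc m                           ≡⟨ cong (λ y → 3 ^ m + (3 ^ m + y)) (+-identityʳ (3 ^ m)) ⟩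
  3 ^ m + (3 ^ m + 3 ^ m)             ≡⟨ sym (+-assoc (3 ^ m) (3 ^ m) (3 ^ m)) ⟩
  3 ^ m + 3 ^ m + 3 ^ m               ≤⟨ +-mono-≤ (+-mono-≤ (dense f0) (dense (fs f0))) (dense (fs (fs f0))) ⟩
  _                                   ≤⟨ children-extensions-≤ t L ⟩
  length L                            ∎))
  where
  open ≤-Reasoning
  dense : ∀ c → 3 ^ m ≤ length (extensions (t ++ [ c ]) L)
  dense c = ≮⇒≥ (λ sparse → none (c , sparse))

avoiding-extension : (m : ℕ) (t : Word) (L : List Word) → length L < 3 ^ m →
                     ∃ λ w → length w ≡ m × (∀ {s} → s ∈ L → ¬ Prefix _≡_ (t ++ w) s)
avoiding-extension zero    t []      _        = [] , refl , λ ()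
avoiding-extension zero    t (_ ∷ _) (s≤s ())
avoiding-extension (suc m) t L       L< with sparse-child m t L L<
... | c , sparse with avoiding-extension m (t ++ [ c ]) (extensions (t ++ [ c ]) L) sparse
... | w , refl , avoids = c ∷ w , refl , λ {s} s∈L p →
  let p′ = subst (λ u → Prefix _≡_ u s) (sym (++-assoc t [ c ] w)) p
  in avoids (∈-filter⁺ (prefix? _≟_ (t ++ [ c ])) s∈L (prefix-++⁻ˡ (t ++ [ c ]) w p′)) p′

module _ {h : ℕ} where

  ⊑⇒height-≥ : {t s : Node h} → t ⊑ s → height s ≤ height t
  ⊑⇒height-≥ t⊑s = ∸-monoʳ-≤ h (length-mono t⊑s)

  any-node? : (a : ℕ) {P : Node h → Set} → Decidable P → Dec (∃ λ t → height t ≡ a × P t)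
  any-node? a {P} P? with a ≤? h
  ... | no  a≰h = no λ ((w , _) , ht , _) → a≰h (subst (_≤ h) ht (m∸n≤m h (length w)))
  ... | yes a≤h = map′ to from (any-word? (h ∸ a) bounded-P?)
    where
    bounded-P? : Decidable (λ w → Σ (length w ≤ h) λ w≤h → P (w , w≤h))
    bounded-P? w with length w ≤? h
    ... | no  w≰h = no (w≰h ∘ proj₁)
    ... | yes w≤h = map′ (w≤h ,_) (λ (w≤h′ , p) → subst (λ b → P (w , b)) (≤-irrelevant w≤h′ w≤h) p)
                         (P? (w , w≤h))
    to : (∃ λ w → length w ≡ h ∸ a × Σ (length w ≤ h) λ w≤h → P (w , w≤h)) →
         ∃ λ t → height t ≡ a × P t
    to (w , e , w≤h , p) = (w , w≤h) , trans (cong (h ∸_) e) (m∸[m∸n]≡n a≤h) , p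
    from : (∃ λ t → height t ≡ a × P t) →
           ∃ λ w → length w ≡ h ∸ a × Σ (length w ≤ h) λ w≤h → P (w , w≤h)
    from ((w , w≤h) , refl , p) = w , sym (m∸[m∸n]≡n w≤h) , w≤h , p

  sparse-descendant : (c : ℕ) (t : Node h) → c ≤ height t → (L : List (Node h)) →
                      length L < 3 ^ c →
                      ∃ λ t* → t ⊑ t* × height t* ≡ height t ∸ c × (∀ {s} → s ∈ L → ¬ t* ⊑ s)
  sparse-descendant c (t , t≤h) c≤ L L< with avoiding-extension c t (map proj₁ L)
                                               (subst (_< 3 ^ c) (sym (length-map proj₁ L)) L<)
  ... | w , refl , avoids =
    (t ++ w , bound) , prefix-++ t w , depth , λ s∈L → avoids (∈-map⁺ proj₁ s∈L)
    where
    bound : length (t ++ w) ≤ h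
    bound = begin
      length (t ++ w)        ≡⟨ length-++ t ⟩
      length t + length w    ≤⟨ +-monoʳ-≤ (length t) c≤ ⟩
      length t + (h ∸ length t) ≡⟨ m+[n∸m]≡n t≤h ⟩
      h                      ∎
      where open ≤-Reasoning
    depth : h ∸ length (t ++ w) ≡ h ∸ length t ∸ length w
    depth = trans (cong (h ∸_) (length-++ t)) (sym (∸-+-assoc h (length t) (length w)))

module _ {h k : ℕ} where

  Uncovered : ℕ → List (Vtx h k) → Node h → Set
  Uncovered a π₀ t = ∃ λ t′ → t ⊑ t′ × height t′ ≡ a × Disjoint π₀ t′

  Meets? : (π₀ : List (Vtx h k)) (t′ : Node h) → Dec (Any (λ v → t′ ⊑ proj₁ v) π₀)
  Meets? π₀ t′ = Any.any? (λ v → t′ ⊑? proj₁ v) π₀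

  Uncovered? : (a : ℕ) (π₀ : List (Vtx h k)) (t : Node h) → Dec (Uncovered a π₀ t)
  Uncovered? a π₀ t =
    map′ (λ (t′ , ht′ , t⊑t′ , ¬meets) → t′ , t⊑t′ , ht′ , λ v∈ t′⊑v → ¬meets (lose v∈ t′⊑v))
         (λ (t′ , t⊑t′ , ht′ , disjoint) → t′ , ht′ , t⊑t′ , λ meets →
            let (v , v∈ , t′⊑v) = find meets in disjoint v∈ t′⊑v)
         (any-node? a (λ t′ → (t ⊑? t′) ×-dec ¬? (Meets? π₀ t′)))

  ¬uncovered⇒covers : ∀ {a π₀ t} → ¬ Uncovered a π₀ t →
                      ∀ t′ → t ⊑ t′ → height t′ ≡ a → ∃ λ v → v ∈ π₀ × t′ ⊑ proj₁ v
  ¬uncovered⇒covers {π₀ = π₀} ¬unc t′ t⊑t′ ht′ with Meets? π₀ t′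
  ... | yes meets = find meets
  ... | no ¬meets = ⊥-elim (¬unc (t′ , t⊑t′ , ht′ , λ v∈ t′⊑v → ¬meets (lose v∈ t′⊑v)))

module _ {h k : ℕ} (π : List (Vtx h k)) (h0 : ℕ) where

  Crossing : Node h → ℕ → Set
  Crossing t n = countVgt h0 t (take n π) < k × k ≤ countVgt h0 t (take (suc n) π)
               × ¬ Uncovered h0 (take (suc n) π) t

  Crossing? : (t : Node h) (n : ℕ) → Dec (Crossing t n)
  Crossing? t n = (countVgt h0 t (take n π) <? k) ×-dec (k ≤? countVgt h0 t (take (suc n) π))
                  ×-dec ¬? (Uncovered? h0 (take (suc n) π) t)

  TD-or-crossing : ∀ h1 → 1 ≤ k → TD π h0 h1 ⊎ ∃ λ t → height t ≡ h1 × ∃ λ n → Crossing t n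
  TD-or-crossing h1 k≥1 with any-node? h1 (λ t → anyUpTo? (Crossing? t) (length π))
  ... | yes (t , ht , n , _ , crossing) = inj₂ (t , ht , n , crossing)
  ... | no  ¬crossing = inj₁ td
    where
    td : TD π h0 h1
    td t ht zero    reached _     = ⊥-elim (<⇒≱ k≥1 reached)
    td t ht (suc n) reached below with Uncovered? h0 (take (suc n) π) t
    ... | yes uncovered = uncovered
    ... | no  covered   = ⊥-elim (¬crossing (t , ht , n , n<|π| , below n ≤-refl , reached , covered))
      where
      n<|π| : n < length π
      n<|π| = ≰⇒> λ |π|≤n → <⇒≱ (below n ≤-refl) (subst (λ π₀ → k ≤ countVgt h0 t π₀)
        (trans (take-all (suc n) π (m≤n⇒m≤1+n |π|≤n)) (sym (take-all n π |π|≤n))) reached)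

  crossing⇒BU : (c : ℕ) → k ≤ 3 ^ c → (t : Node h) → c ≤ height t →
                (n : ℕ) → Crossing t n → BU π h0 (height t ∸ c)
  crossing⇒BU c k≤3^c t c≤ n (below , reached , ¬uncovered)
    with sparse-descendant c t c≤ (map proj₁ counted)
           (subst (_< 3 ^ c) (sym (length-map proj₁ counted)) (<-≤-trans below k≤3^c))
    where counted = filter (InVgt? h0 t) (take n π)
  ... | t* , t⊑t* , ht* , avoids = t* , ht* , n , covers , λ v∈ (t*⊑v , v>h0) →
    avoids (∈-map⁺ proj₁ (∈-filter⁺ (InVgt? h0 t) v∈ (prefix-trans trans t⊑t* t*⊑v , v>h0))) t*⊑v
    where
    covers : ∀ t′ → t* ⊑ t′ → height t′ ≡ h0 → ∃ λ v → v ∈ take n π × t′ ⊑ proj₁ v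
    covers t′ t*⊑t′ ht′
      with ¬uncovered⇒covers {a = h0} {take (suc n) π} {t} ¬uncovered t′ (prefix-trans trans t⊑t* t*⊑t′) ht′
    ... | v , v∈ , t′⊑v with ∈-take-suc⁻ (InVgt? h0 t) n π (<-≤-trans below reached) v∈
    ... | inj₁ v∈′         = v , v∈′ , t′⊑v
    ... | inj₂ (_ , v>h0) =
      ⊥-elim (<⇒≱ v>h0 (subst (height (proj₁ v) ≤_) ht′ (⊑⇒height-≥ {t = t′} {proj₁ v} t′⊑v)))

lemma10 : (h k : ℕ) → 1 ≤ k → (π : List (Vtx h k)) → IsPerm π →
          (h0 h1 : ℕ) → k < 3 ^ (h1 ∸ suc h0) → h1 ≤ h →
          ¬ TD π h0 h1 →
          (c : ℕ) → k ≤ 3 ^ c → (∀ c' → c' < c → 3 ^ c' < k) →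
          BU π h0 (h1 ∸ c)
lemma10 h k k≥1 π _ h0 h1 k<3^ _ ¬td c k≤3^c minimal with TD-or-crossing π h0 h1 k≥1
... | inj₁ td = ⊥-elim (¬td td)
... | inj₂ (t , refl , n , crossing) = crossing⇒BU π h0 c k≤3^c t c≤h1 n crossing
  where
  c≤h1 : c ≤ h1
  c≤h1 = ≮⇒≥ λ h1<c → <⇒≱ (minimal h1 h1<c)
    (<⇒≤ (<-≤-trans k<3^ (^-monoʳ-≤ 3 (m∸n≤m h1 (suc h0)))))
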